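{- Let $\mathbf P=(P,\leq,{}',0,1)$ be an orthogonal lub-complete poset. Then the following are equivalent: (i) $\mathbf P$ is a paraorthomodular poset; (ii) for all $x,y\in P$, $x\rightarrow_K y=\{1\}$ implies $x\leq y$; (iii) for all $x,y\in P$, $x\rightarrow_N y=\{1\}$ implies $x\leq y$.
   Context: For a poset $(P,\leq)$ and $A\subseteq P$: $L(A)=\{x: x\leq a\ \forall a\in A\}$, $U(A)=\{x: a\leq x\ \forall a\in A\}$, $L(x,y)=L(\{x,y\})$, $U(x,y)=U(\{x,y\})$; $\operatorname{Max}A$, $\operatorname{Min}A$: maximal/minimal elements of $A$. Statements $x\wedge y=0$ mean the infimum exists and equals $0$. A bounded poset $(P,\leq,{}',0,1)$ with antitone involution: $x\leq y\Rightarrow y'\leq x'$, $x''=x$. $x\perp y$ iff $x\leq y'$. Orthogonal: $x\perp y$ implies the supremum $x\vee y$ exists. Lub-complete: for every finite $M\subseteq P$ and lower bound $x$ of $M$ there is a maximal element of $L(M)$ above $x$. Paraorthomodular: $x\leq y$ and $x'\wedge y=0$ imply $x=y$. Kalmbach implication: $x\rightarrow_K y=\{(a\vee b)\vee(x\wedge c): a\in\operatorname{Max}L(x',y), b\in\operatorname{Max}L(x',y'), c\in\operatorname{Min}U(x',y)\}$; non-tolens implication: $x\rightarrow_N y=y'\rightarrow_K x'$. -}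

module Defs where

open import Level using (Level; _⊔_; suc)
open import Data.Product using (Σ; ∃; ∃-syntax; _×_; _,_)
open import Data.Sum using (_⊎_)
open import Data.List using (List)
open import Data.List.Membership.Propositional using (_∈_)
open import Relation.Binary.Core using (Rel)
open import Relation.Binary.Structures using (IsPartialOrder)
open import Relation.Binary.PropositionalEquality using (_≡_)

record BoundedPosetAI (c ℓ : Level) : Set (suc (c ⊔ ℓ)) where
  infix 4 _≤_
  infix 8 _′
  field
    Carrier        : Set c
    _≤_            : Rel Carrier ℓ
    isPartialOrder : IsPartialOrder _≡_ _≤_
    _′             : Carrier → Carrier
    𝟘              : Carrier
    𝟙              : Carrier
    𝟘-least        : ∀ x → 𝟘 ≤ x
    𝟙-greatest     : ∀ x → x ≤ 𝟙
    antitone       : ∀ {x y} → x ≤ y → y ′ ≤ x ′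
    involutive     : ∀ x → (x ′) ′ ≡ x

module _ {c ℓ : Level} (P : BoundedPosetAI c ℓ) where
  open BoundedPosetAI P

  Subset : (k : Level) → Set (c ⊔ Level.suc k)
  Subset k = Carrier → Set k

  pair : Carrier → Carrier → Subset c
  pair x y a = a ≡ x ⊎ a ≡ y

  Lo : ∀ {k} → Subset k → Subset (c ⊔ ℓ ⊔ k)
  Lo A z = ∀ a → A a → z ≤ a

  Up : ∀ {k} → Subset k → Subset (c ⊔ ℓ ⊔ k)
  Up A z = ∀ a → A a → a ≤ z

  L₂ : Carrier → Carrier → Subset (c ⊔ ℓ)
  L₂ x y = Lo (pair x y)

  U₂ : Carrier → Carrier → Subset (c ⊔ ℓ)
  U₂ x y = Up (pair x y)

  IsMax : ∀ {k} → Subset k → Carrier → Set (c ⊔ ℓ ⊔ k)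
  IsMax A m = A m × (∀ w → A w → m ≤ w → w ≡ m)

  IsMin : ∀ {k} → Subset k → Carrier → Set (c ⊔ ℓ ⊔ k)
  IsMin A m = A m × (∀ w → A w → w ≤ m → w ≡ m)

  IsSup : Carrier → Carrier → Carrier → Set (c ⊔ ℓ)
  IsSup x y z = x ≤ z × y ≤ z × (∀ w → x ≤ w → y ≤ w → z ≤ w)

  IsInf : Carrier → Carrier → Carrier → Set (c ⊔ ℓ)
  IsInf x y z = z ≤ x × z ≤ y × (∀ w → w ≤ x → w ≤ y → w ≤ z)

  _⊥_ : Carrier → Carrier → Set ℓ
  x ⊥ y = x ≤ y ′

  Orthogonal : Set (c ⊔ ℓ)
  Orthogonal = ∀ x y → x ⊥ y → ∃[ z ] IsSup x y z

  LubComplete : Set (c ⊔ ℓ)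
  LubComplete = ∀ (M : List Carrier) x → Lo (_∈ M) x →
                ∃[ m ] (IsMax (Lo (_∈ M)) m × x ≤ m)

  Paraorthomodular : Set (c ⊔ ℓ)
  Paraorthomodular = ∀ x y → x ≤ y → IsInf (x ′) y 𝟘 → x ≡ y

  -- z ∈ x →K y  iff  z = (a ∨ b) ∨ (x ∧ c) for some a ∈ Max L(x',y),
  -- b ∈ Max L(x',y'), c ∈ Min U(x',y)  (all suprema/infima existing)
  _∈→K_,_ : Carrier → Carrier → Carrier → Set (c ⊔ ℓ)
  z ∈→K x , y =
    ∃[ a ] ∃[ b ] ∃[ c′ ] ∃[ d ] ∃[ e ]
      ( IsMax (L₂ (x ′) y) a × IsMax (L₂ (x ′) (y ′)) b × IsMin (U₂ (x ′) y) c′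
      × IsSup a b d × IsInf x c′ e × IsSup d e z )

  _∈→N_,_ : Carrier → Carrier → Carrier → Set (c ⊔ ℓ)
  z ∈→N x , y = z ∈→K (y ′) , (x ′)

  K-is-𝟙 : Carrier → Carrier → Set (c ⊔ ℓ)
  K-is-𝟙 x y = ∀ z → (z ∈→K x , y → z ≡ 𝟙) × (z ≡ 𝟙 → z ∈→K x , y)

  N-is-𝟙 : Carrier → Carrier → Set (c ⊔ ℓ)
  N-is-𝟙 x y = ∀ z → (z ∈→N x , y → z ≡ 𝟙) × (z ≡ 𝟙 → z ∈→N x , y)

  CondK : Set (c ⊔ ℓ)
  CondK = ∀ x y → K-is-𝟙 x y → x ≤ y

  CondN : Set (c ⊔ ℓ)
  CondN = ∀ x y → N-is-𝟙 x y → x ≤ y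

module Submission where

-- (i) ⇒ (ii): if x →K y = {1}, write 1 = d ∨ e with d = a ∨ b ≤ x′ and e = x ∧ c ≤ x.
-- Since d′ ∧ e′ = 0, paraorthomodularity forces e = d′, so x = e and x′ = d; varying c over
-- Min U(x′,y) shows x lies below all of them, whence x ∧ y′ = 0, and paraorthomodularity
-- once more gives b = y′ ≤ x′.
-- (ii) ⇒ (i): if x ≤ y and x′ ∧ y = 0, every element z of y →K x lies above y′ (as y′ is
-- the largest element of L(y′,x′)) and above x, so z′ ≤ x′ ∧ y = 0; lub-completeness and
-- orthogonality make y →K x nonempty, so y →K x = {1} and y ≤ x.
-- Condition (iii) is (ii) transported along the involution.

open import Defs
open import Level using (Level)
open import Function using (_∘_)
open import Data.Product using (_×_; _,_; proj₁; proj₂; ∃-syntax)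
open import Data.Sum using (inj₁; inj₂)
open import Data.List using (_∷_; [])
open import Data.List.Relation.Unary.Any using (here; there)
open import Data.List.Membership.Propositional using (_∈_)
open import Relation.Binary.PropositionalEquality using (_≡_; refl; sym; trans; subst; subst₂; cong)
open import Relation.Binary.Structures using (IsPartialOrder)

module _ {c ℓ : Level} (P : BoundedPosetAI c ℓ) where
  open BoundedPosetAI P
  open IsPartialOrder isPartialOrder using (antisym) renaming (refl to ≤-refl; trans to ≤-trans)

  ≤′-swap : ∀ {x y} → x ≤ y ′ → y ≤ x ′
  ≤′-swap {x} {y} x≤y′ = subst (_≤ x ′) (involutive y) (antitone x≤y′)

  ′≤-swap : ∀ {x y} → x ′ ≤ y → y ′ ≤ x
  ′≤-swap {x} {y} x′≤y = subst (y ′ ≤_) (involutive x) (antitone x′≤y)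

  ′-cancel : ∀ {x y} → x ′ ≤ y ′ → y ≤ x
  ′-cancel {x} {y} x′≤y′ = subst₂ _≤_ (involutive y) (involutive x) (antitone x′≤y′)

  𝟘′≡𝟙 : 𝟘 ′ ≡ 𝟙
  𝟘′≡𝟙 = antisym (𝟙-greatest _) (≤′-swap (𝟘-least (𝟙 ′)))

  𝟙′≡𝟘 : 𝟙 ′ ≡ 𝟘
  𝟙′≡𝟘 = trans (cong _′ (sym 𝟘′≡𝟙)) (involutive 𝟘)

  𝟙≤′⇒≤𝟘 : ∀ {x} → 𝟙 ≤ x ′ → x ≤ 𝟘
  𝟙≤′⇒≤𝟘 𝟙≤x′ = subst (_ ≤_) 𝟙′≡𝟘 (≤′-swap 𝟙≤x′)

  ′≤𝟘⇒≡𝟙 : ∀ {x} → x ′ ≤ 𝟘 → x ≡ 𝟙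
  ′≤𝟘⇒≡𝟙 x′≤𝟘 = antisym (𝟙-greatest _) (subst (_≤ _) 𝟘′≡𝟙 (′≤-swap x′≤𝟘))

  L₂-intro : ∀ {u v z} → z ≤ u → z ≤ v → L₂ P u v z
  L₂-intro z≤u z≤v _ (inj₁ refl) = z≤u
  L₂-intro z≤u z≤v _ (inj₂ refl) = z≤v

  L₂-≤ˡ : ∀ {u v z} → L₂ P u v z → z ≤ u
  L₂-≤ˡ z∈L = z∈L _ (inj₁ refl)

  L₂-≤ʳ : ∀ {u v z} → L₂ P u v z → z ≤ v
  L₂-≤ʳ z∈L = z∈L _ (inj₂ refl)

  U₂-intro : ∀ {u v z} → u ≤ z → v ≤ z → U₂ P u v z
  U₂-intro u≤z v≤z _ (inj₁ refl) = u≤z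
  U₂-intro u≤z v≤z _ (inj₂ refl) = v≤z

  U₂-≥ˡ : ∀ {u v z} → U₂ P u v z → u ≤ z
  U₂-≥ˡ z∈U = z∈U _ (inj₁ refl)

  U₂-≥ʳ : ∀ {u v z} → U₂ P u v z → v ≤ z
  U₂-≥ʳ z∈U = z∈U _ (inj₂ refl)

  Lo-pair⇒L₂ : ∀ {u v z} → Lo P (_∈ (u ∷ v ∷ [])) z → L₂ P u v z
  Lo-pair⇒L₂ z∈L = L₂-intro (z∈L _ (here refl)) (z∈L _ (there (here refl)))

  L₂⇒Lo-pair : ∀ {u v z} → L₂ P u v z → Lo P (_∈ (u ∷ v ∷ [])) z
  L₂⇒Lo-pair z∈L _ (here refl)         = L₂-≤ˡ z∈L
  L₂⇒Lo-pair z∈L _ (there (here refl)) = L₂-≤ʳ z∈L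

  sup-least : ∀ {x y s w} → IsSup P x y s → x ≤ w → y ≤ w → s ≤ w
  sup-least (_ , _ , least) = least _

  sup-𝟙⇒inf-′-𝟘 : ∀ {x y} → IsSup P x y 𝟙 → IsInf P (x ′) (y ′) 𝟘
  sup-𝟙⇒inf-′-𝟘 𝟙-sup =
    𝟘-least _ , 𝟘-least _ , λ w w≤x′ w≤y′ → 𝟙≤′⇒≤𝟘 (sup-least 𝟙-sup (≤′-swap w≤x′) (≤′-swap w≤y′))

  max-L₂′⇒min-U₂ : ∀ {u v m} → IsMax P (L₂ P (u ′) (v ′)) m → IsMin P (U₂ P u v) (m ′)
  max-L₂′⇒min-U₂ (m∈L , m-max) =
    U₂-intro (≤′-swap (L₂-≤ˡ m∈L)) (≤′-swap (L₂-≤ʳ m∈L)) ,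
    λ w w∈U w≤m′ → trans (sym (involutive w))
      (cong _′ (m-max (w ′) (L₂-intro (antitone (U₂-≥ˡ w∈U)) (antitone (U₂-≥ʳ w∈U))) (≤′-swap w≤m′)))

  paraorthomodular⇒≡′ : Paraorthomodular P → ∀ {d e} → e ≤ d ′ → IsSup P d e 𝟙 → e ≡ d ′
  paraorthomodular⇒≡′ par {d} {e} e≤d′ 𝟙-sup = par e (d ′) e≤d′ (inf-sym (sup-𝟙⇒inf-′-𝟘 𝟙-sup))
    where
    inf-sym : IsInf P (d ′) (e ′) 𝟘 → IsInf P (e ′) (d ′) 𝟘
    inf-sym (p , q , greatest) = q , p , λ w w≤e′ w≤d′ → greatest w w≤d′ w≤e′

  module _ (lub : LubComplete P) where

    max-L₂-above : ∀ {u v w} → w ≤ u → w ≤ v → ∃[ m ] (IsMax P (L₂ P u v) m × w ≤ m)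
    max-L₂-above w≤u w≤v with lub _ _ (L₂⇒Lo-pair (L₂-intro w≤u w≤v))
    ... | m , (m∈L , m-max) , w≤m =
      m , (Lo-pair⇒L₂ m∈L , λ w' w'∈L m≤w' → m-max w' (L₂⇒Lo-pair w'∈L) m≤w') , w≤m

    min-U₂-below : ∀ {u v t} → u ≤ t → v ≤ t → ∃[ m ] (IsMin P (U₂ P u v) m × m ≤ t)
    min-U₂-below u≤t v≤t with max-L₂-above (antitone u≤t) (antitone v≤t)
    ... | m , m-max , t′≤m = m ′ , max-L₂′⇒min-U₂ m-max , ′≤-swap t′≤m

  module _ (orth : Orthogonal P) where

    inf-exists : ∀ {x y} → x ′ ≤ y → ∃[ i ] IsInf P x y i
    inf-exists {x} {y} x′≤y with orth (x ′) (y ′) (subst (x ′ ≤_) (sym (involutive y)) x′≤y)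
    ... | s , x′≤s , y′≤s , least =
      s ′ , ′≤-swap x′≤s , ′≤-swap y′≤s , λ w w≤x w≤y → ≤′-swap (least (w ′) (antitone w≤x) (antitone w≤y))

    sup-inf-exists : ∀ {x d c} → d ≤ x ′ → x ′ ≤ c → ∃[ e ] ∃[ z ] (IsInf P x c e × IsSup P d e z)
    sup-inf-exists d≤x′ x′≤c with inf-exists x′≤c
    ... | e , e-inf@(e≤x , _) with orth _ e (≤-trans d≤x′ (antitone e≤x))
    ... | z , z-sup = e , z , e-inf , z-sup

  module _ (orth : Orthogonal P) (lub : LubComplete P) where

    →K-nonempty : ∀ x y → ∃[ z ] _∈→K_,_ P z x y
    →K-nonempty x y
      with max-L₂-above lub (𝟘-least (x ′)) (𝟘-least y)
         | max-L₂-above lub (𝟘-least (x ′)) (𝟘-least (y ′))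
         | min-U₂-below lub (𝟙-greatest (x ′)) (𝟙-greatest y)
    ... | a , a-max@(a∈L , _) , _ | b , b-max@(b∈L , _) , _ | c₀ , c-min@(c∈U , _) , _
      with orth a b (≤-trans (L₂-≤ʳ a∈L) (≤′-swap (L₂-≤ʳ b∈L)))
    ... | d , d-sup with sup-inf-exists orth (sup-least d-sup (L₂-≤ˡ a∈L) (L₂-≤ˡ b∈L)) (U₂-≥ˡ c∈U)
    ... | e , z , e-inf , z-sup = z , a , b , c₀ , d , e , a-max , b-max , c-min , d-sup , e-inf , z-sup

    paraorthomodular⇒condK : Paraorthomodular P → CondK P
    paraorthomodular⇒condK par x y x→y≡𝟙
      with proj₂ (x→y≡𝟙 𝟙) refl
    ... | a , b , _ , d , e , a-max@(a∈L , _) , b-max@(b∈L , _) , _ , d-sup , (e≤x , _) , 𝟙-sup =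
      ′-cancel (subst (_≤ x ′) b≡y′ (L₂-≤ˡ b∈L))
      where
      d≤x′ : d ≤ x ′
      d≤x′ = sup-least d-sup (L₂-≤ˡ a∈L) (L₂-≤ˡ b∈L)

      x≤d′ : x ≤ d ′
      x≤d′ = ≤′-swap d≤x′

      complement : ∀ {e₀} → e₀ ≤ x → IsSup P d e₀ 𝟙 → e₀ ≡ d ′
      complement e₀≤x = paraorthomodular⇒≡′ par (≤-trans e₀≤x x≤d′)

      x′≤d : x ′ ≤ d
      x′≤d = ′≤-swap (subst (_≤ x) (complement e≤x 𝟙-sup) e≤x)

      -- each choice of c ∈ Min U(x′,y) yields another element d ∨ (x ∧ c) of x →K y = {1}
      below-min-U₂ : ∀ {c₁} → IsMin P (U₂ P (x ′) y) c₁ → x ≤ c₁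
      below-min-U₂ c₁-min@(c₁∈U , _) with sup-inf-exists orth d≤x′ (U₂-≥ˡ c₁∈U)
      ... | e₁ , z , e₁-inf@(e₁≤x , e₁≤c₁ , _) , z-sup =
        ≤-trans (subst (x ≤_) (sym (complement e₁≤x 𝟙-sup₁)) x≤d′) e₁≤c₁
        where
        z≡𝟙 : z ≡ 𝟙
        z≡𝟙 = proj₁ (x→y≡𝟙 z) (a , b , _ , d , e₁ , a-max , b-max , c₁-min , d-sup , e₁-inf , z-sup)

        𝟙-sup₁ : IsSup P d e₁ 𝟙
        𝟙-sup₁ = subst (IsSup P d e₁) z≡𝟙 z-sup

      x∧x′≡𝟘 : ∀ {w} → w ≤ x → w ≤ x ′ → w ≤ 𝟘
      x∧x′≡𝟘 {w} w≤x w≤x′ =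
        proj₂ (proj₂ (sup-𝟙⇒inf-′-𝟘 𝟙-sup)) w (≤-trans w≤x x≤d′) (≤-trans w≤x′ (antitone e≤x))

      x∧y′≡𝟘 : ∀ {w} → w ≤ x → w ≤ y ′ → w ≤ 𝟘
      x∧y′≡𝟘 w≤x w≤y′ with min-U₂-below lub (antitone w≤x) (≤′-swap w≤y′)
      ... | _ , c₂-min , c₂≤w′ = x∧x′≡𝟘 w≤x (≤′-swap (≤-trans (below-min-U₂ c₂-min) c₂≤w′))

      b′∧y′≤x : ∀ {w} → w ≤ b ′ → w ≤ y ′ → w ≤ x
      b′∧y′≤x w≤b′ w≤y′ =
        ′-cancel (≤-trans x′≤d (sup-least d-sup (≤-trans (L₂-≤ʳ a∈L) (≤′-swap w≤y′)) (≤′-swap w≤b′)))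

      b≡y′ : b ≡ y ′
      b≡y′ = par b (y ′) (L₂-≤ʳ b∈L)
        (𝟘-least _ , 𝟘-least _ , λ _ w≤b′ w≤y′ → x∧y′≡𝟘 (b′∧y′≤x w≤b′ w≤y′) w≤y′)

    condK⇒paraorthomodular : CondK P → Paraorthomodular P
    condK⇒paraorthomodular condK x y x≤y (_ , _ , x′∧y-greatest) = antisym x≤y (condK y x y→x≡𝟙)
      where
      member≡𝟙 : ∀ {z} → _∈→K_,_ P z y x → z ≡ 𝟙
      member≡𝟙 {z} (_ , b , _ , _ , _ , _ , (b∈L , b-max) , (c∈U , _)
                   , (_ , b≤d , _) , (_ , _ , e-greatest) , (d≤z , e≤z , _)) =
        ′≤𝟘⇒≡𝟙 (x′∧y-greatest (z ′) (antitone x≤z) (′≤-swap y′≤z))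
        where
        y′≡b : y ′ ≡ b
        y′≡b = b-max (y ′) (L₂-intro ≤-refl (antitone x≤y)) (L₂-≤ˡ b∈L)

        y′≤z : y ′ ≤ z
        y′≤z = ≤-trans (subst (_≤ _) (sym y′≡b) b≤d) d≤z

        x≤z : x ≤ z
        x≤z = ≤-trans (e-greatest x x≤y (U₂-≥ʳ c∈U)) e≤z

      y→x≡𝟙 : K-is-𝟙 P y x
      y→x≡𝟙 _ = member≡𝟙 , λ { refl → 𝟙∈y→x (→K-nonempty y x) }
        where
        𝟙∈y→x : ∃[ z ] _∈→K_,_ P z y x → _∈→K_,_ P 𝟙 y x
        𝟙∈y→x (z , z∈) = subst (λ t → _∈→K_,_ P t y x) (member≡𝟙 z∈) z∈

  condK⇒condN : CondK P → CondN P
  condK⇒condN condK x y x→y≡𝟙 = ′-cancel (condK (y ′) (x ′) x→y≡𝟙)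

  condN⇒condK : CondN P → CondK P
  condN⇒condK condN x y x→y≡𝟙 =
    ′-cancel (condN (y ′) (x ′) (subst₂ (K-is-𝟙 P) (sym (involutive x)) (sym (involutive y)) x→y≡𝟙))

theorem5 : ∀ {c ℓ : Level} (P : BoundedPosetAI c ℓ) → Orthogonal P → LubComplete P →
             ((Paraorthomodular P → CondK P) × (CondK P → Paraorthomodular P))
             × ((Paraorthomodular P → CondN P) × (CondN P → Paraorthomodular P))
theorem5 P orth lub =
  (i⇒ii , ii⇒i) , (condK⇒condN P ∘ i⇒ii , ii⇒i ∘ condN⇒condK P)
  where
  i⇒ii : Paraorthomodular P → CondK P
  i⇒ii = paraorthomodular⇒condK P orth lub

  ii⇒i : CondK P → Paraorthomodular P
  ii⇒i = condK⇒paraorthomodular P orth lub
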